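{- Let $m'=6j+1$ be a prime, where $j$ is a positive integer. Then for every integer $n\ge0$ such that $n\equiv\varepsilon a\pmod{6m'}$ for some $\varepsilon\in\{1,-1\}$ and $a\in\{0,1,2,2m'-1,2m'+2\}$, and for every $i\in\{0,1,\ldots,m'-1\}$, $$\#\{\lambda\in P(n,3):\lambda_1-\lambda_3\equiv i\pmod{m'}\}=\frac{p(n,3)}{m'};$$ that is, $c_{LS}(\lambda)=\lambda_1-\lambda_3\bmod m'$ is a crank witnessing $p(n,3)\equiv0\pmod{m'}$ for all such $n$.
   Context: $P(n,3)$ is the set of partitions of $n$ into exactly three parts, identified with integer vectors $\lambda=(\lambda_1,\lambda_2,\lambda_3)$ with $\lambda_1+\lambda_2+\lambda_3=n$ and $\lambda_1\ge\lambda_2\ge\lambda_3>0$; $p(n,3)=\#P(n,3)$. -}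

module Defs where

open import Data.Nat using (ℕ; zero; suc; _+_; _*_; _∸_; _≤_; _<_; _≡ᵇ_; NonZero)
open import Data.Nat.DivMod using (_%_)
open import Data.Nat.Properties using (_≟_; _≤?_)
open import Data.List using (List; []; _∷_; length; filter; concatMap; upTo; map)
open import Data.Sum using (_⊎_)
open import Data.Product using (_×_; _,_; proj₁; proj₂)
open import Relation.Binary.PropositionalEquality using (_≡_)
open import Relation.Nullary.Decidable using (_×-dec_)

Triple : Set
Triple = ℕ × ℕ × ℕ

λ₁ λ₂ λ₃ : Triple → ℕ
λ₁ t = proj₁ t
λ₂ t = proj₁ (proj₂ t)
λ₃ t = proj₂ (proj₂ t)

IsPartition3 : ℕ → Triple → Set
IsPartition3 n t = (λ₁ t + λ₂ t + λ₃ t ≡ n) × (λ₂ t ≤ λ₁ t) × (λ₃ t ≤ λ₂ t) × (0 < λ₃ t)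

candidates : ℕ → List Triple
candidates n = concatMap (λ a → concatMap (λ b → map (λ c → (a , b , c)) (upTo (suc n))) (upTo (suc n))) (upTo (suc n))

-- P(n,3) as an explicit (duplicate-free) list: every partition of n into three
-- parts has all entries ≤ n, so filtering the candidates gives exactly P(n,3).
P3 : ℕ → List Triple
P3 n = filter (λ t → (λ₁ t + λ₂ t + λ₃ t ≟ n) ×-dec (λ₂ t ≤? λ₁ t) ×-dec (λ₃ t ≤? λ₂ t) ×-dec (1 ≤? λ₃ t)) (candidates n)

p3 : ℕ → ℕ
p3 n = length (P3 n)

-- #{λ ∈ P(n,3) : λ₁ - λ₃ ≡ i (mod m)}   (note λ₁ ≥ λ₃ so λ₁ ∸ λ₃ is the true difference)
crankCount : (m : ℕ) .{{_ : NonZero m}} → ℕ → ℕ → ℕ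
crankCount m n i = length (filter (λ t → ((λ₁ t ∸ λ₃ t) % m) ≟ (i % m)) (P3 n))

-- n ≡ ε·a (mod M) for ε ∈ {1,-1}, with n ≥ 0: either n ≡ a or n + a ≡ 0 (mod M).
CongPM : (M : ℕ) .{{_ : NonZero M}} → ℕ → ℕ → Set
CongPM M n a = (n % M ≡ a % M) ⊎ ((n + a) % M ≡ 0)

m′ : ℕ → ℕ
m′ j = suc (6 * j)

-- n ≡ ε a (mod 6m') for some ε ∈ {1,-1}; the modulus 6m' = 36j+6 is written suc (5 + 6*(6j)) so NonZero is found.
CongPM6 : (j n a : ℕ) → Set
CongPM6 j n a = CongPM (suc (5 + 6 * (6 * j))) n a

-- Write a partition as λ = (c + s, n ∸ 2c ∸ s, c). The partitions with smallest part c are exactly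
-- those with K ≤ 2s ≤ 2K, where K = n ∸ 3c runs over n % 3 + 3u, u < n / 3. Counting s < y with
-- s ≡ i (mod m) gives ⌊y/m⌋ + [i % m < y % m], so with k = K + 1 the number of λ with λ₁ ∸ λ₃ ≡ i is
-- the sum over u of ⌊k/m⌋ ∸ ⌊⌊k/2⌋/m⌋ plus [i % m < k % m] ∸ [i % m < ⌊k/2⌋ % m]. The first part does
-- not involve i, and the second sums to a quantity independent of i as soon as the residues of k and
-- of ⌊k/2⌋ mod m agree as multisets. For m = 6j + 1 this balance is 2m-periodic in the number of
-- rows and holds at each residue n ≡ ±a (mod 6m) of the statement, so all m classes have the same
-- size p(n,3)/m.
module Submission where

open import Data.Bool using (true; false; if_then_else_)
open import Data.Empty using (⊥-elim)
open import Data.List using (List; []; _∷_; length; filter; concatMap; map; applyUpTo; upTo; _++_)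
open import Data.Nat
open import Data.Nat.DivMod
open import Data.Nat.Divisibility using (divides)
open import Data.Nat.Primality using (Prime)
open import Data.Nat.Properties
open import Data.Nat.Tactic.RingSolver using (solve-∀)
open import Data.Product using (_×_; _,_; proj₁; proj₂)
open import Data.Sum using (_⊎_; inj₁; inj₂; [_,_])
open import Function using (_∘_)
open import Relation.Binary.Definitions using (Tri; tri<; tri≈; tri>)
open import Relation.Binary.PropositionalEquality using (_≡_; refl; sym; trans; cong; cong₂; subst; subst₂; module ≡-Reasoning)
open import Relation.Nullary using (Dec; yes; no; does; ¬_)
open import Relation.Nullary.Decidable using (_×-dec_)

open import Defs

∑ : (ℕ → ℕ) → ℕ → ℕ
∑ f zero    = 0
∑ f (suc N) = f 0 + ∑ (f ∘ suc) N

∑-cong< : ∀ {f g} N → (∀ u → u < N → f u ≡ g u) → ∑ f N ≡ ∑ g N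
∑-cong< zero    f≡g = refl
∑-cong< (suc N) f≡g = cong₂ _+_ (f≡g 0 z<s) (∑-cong< N (λ u u<N → f≡g (suc u) (s<s u<N)))

∑-cong : ∀ {f g} N → (∀ u → f u ≡ g u) → ∑ f N ≡ ∑ g N
∑-cong N f≡g = ∑-cong< N (λ u _ → f≡g u)

∑-zero : ∀ (f : ℕ → ℕ) N → (∀ u → u < N → f u ≡ 0) → ∑ f N ≡ 0
∑-zero f zero    f≡0 = refl
∑-zero f (suc N) f≡0 rewrite f≡0 0 z<s = ∑-zero (f ∘ suc) N (λ u u<N → f≡0 (suc u) (s<s u<N))

∑-suc : ∀ (f : ℕ → ℕ) N → ∑ f (suc N) ≡ ∑ f N + f N
∑-suc f zero    = +-comm (f 0) 0
∑-suc f (suc N) = trans (cong (f 0 +_) (∑-suc (f ∘ suc) N)) (sym (+-assoc (f 0) _ _))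

∑-split : ∀ (f : ℕ → ℕ) A B → ∑ f (A + B) ≡ ∑ f A + ∑ (λ u → f (A + u)) B
∑-split f zero    B = refl
∑-split f (suc A) B = trans (cong (f 0 +_) (∑-split (f ∘ suc) A B)) (sym (+-assoc (f 0) _ _))

∑-distrib-+ : ∀ (f g : ℕ → ℕ) N → ∑ (λ u → f u + g u) N ≡ ∑ f N + ∑ g N
∑-distrib-+ f g zero    = refl
∑-distrib-+ f g (suc N) =
  trans (cong (f 0 + g 0 +_) (∑-distrib-+ (f ∘ suc) (g ∘ suc) N))
        (+-interchange (f 0) (g 0) _ _)
  where
  +-interchange : ∀ a b c d → a + b + (c + d) ≡ a + c + (b + d)
  +-interchange = solve-∀

∑-distribˡ-* : ∀ k (f : ℕ → ℕ) N → ∑ (λ u → k * f u) N ≡ k * ∑ f N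
∑-distribˡ-* k f zero    = sym (*-zeroʳ k)
∑-distribˡ-* k f (suc N) =
  trans (cong (k * f 0 +_) (∑-distribˡ-* k (f ∘ suc) N)) (sym (*-distribˡ-+ k (f 0) _))

∑-const : ∀ k N → ∑ (λ _ → k) N ≡ N * k
∑-const k zero    = refl
∑-const k (suc N) = cong (k +_) (∑-const k N)

∑-comm : ∀ (f : ℕ → ℕ → ℕ) A B → ∑ (λ x → ∑ (f x) B) A ≡ ∑ (λ y → ∑ (λ x → f x y) A) B
∑-comm f zero    B = sym (∑-zero _ B (λ _ _ → refl))
∑-comm f (suc A) B = begin
    ∑ (f 0) B + ∑ (λ x → ∑ (f (suc x)) B) A
  ≡⟨ cong (∑ (f 0) B +_) (∑-comm (f ∘ suc) A B) ⟩
    ∑ (f 0) B + ∑ (λ y → ∑ (λ x → f (suc x) y) A) B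
  ≡⟨ ∑-distrib-+ (f 0) _ B ⟨
    ∑ (λ y → ∑ (λ x → f x y) (suc A)) B
  ∎
  where open ≡-Reasoning

∑-reverse : ∀ (f : ℕ → ℕ) N → ∑ (λ u → f (N ∸ suc u)) N ≡ ∑ f N
∑-reverse f zero    = refl
∑-reverse f (suc N) = begin
    f N + ∑ (λ u → f (N ∸ suc u)) N ≡⟨ cong (f N +_) (∑-reverse f N) ⟩
    f N + ∑ f N                     ≡⟨ +-comm (f N) _ ⟩
    ∑ f N + f N                     ≡⟨ ∑-suc f N ⟨
    ∑ f (suc N)                     ∎
  where open ≡-Reasoning

∑-pairs : ∀ (f : ℕ → ℕ) M → ∑ f (M + M) ≡ ∑ (λ w → f (w + w) + f (suc (w + w))) M
∑-pairs f zero    = refl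
∑-pairs f (suc M) = begin
    ∑ f (suc M + suc M)
  ≡⟨ cong (λ k → ∑ f (suc k)) (+-suc M M) ⟩
    f 0 + (f 1 + ∑ (f ∘ suc ∘ suc) (M + M))
  ≡⟨ cong (λ z → f 0 + (f 1 + z)) (∑-pairs (f ∘ suc ∘ suc) M) ⟩
    f 0 + (f 1 + ∑ (λ w → f (2 + (w + w)) + f (3 + (w + w))) M)
  ≡⟨ +-assoc (f 0) (f 1) _ ⟨
    f 0 + f 1 + ∑ (λ w → f (2 + (w + w)) + f (3 + (w + w))) M
  ≡⟨ cong (f 0 + f 1 +_) (∑-cong M (λ w → cong₂ _+_ (cong (f ∘ suc) (+-suc w w))
                                                    (cong (f ∘ suc ∘ suc) (+-suc w w)))) ⟨
    ∑ (λ w → f (w + w) + f (suc (w + w))) (suc M)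
  ∎
  where open ≡-Reasoning

∑-shift : ∀ (G : ℕ → ℕ) c U → (∀ a → a < c → G a ≡ 0) → (∀ a → U ≤ a → G a ≡ 0) →
          ∑ G U ≡ ∑ (λ s → G (c + s)) U
∑-shift G c U G<c≡0 G≥U≡0 = begin
    ∑ G U                             ≡⟨ +-identityʳ _ ⟨
    ∑ G U + 0                         ≡⟨ cong (∑ G U +_) (∑-zero _ c (λ v _ → G≥U≡0 (U + v) (m≤m+n U v))) ⟨
    ∑ G U + ∑ (λ v → G (U + v)) c     ≡⟨ ∑-split G U c ⟨
    ∑ G (U + c)                       ≡⟨ cong (∑ G) (+-comm U c) ⟩
    ∑ G (c + U)                       ≡⟨ ∑-split G c U ⟩
    ∑ G c + ∑ (λ s → G (c + s)) U     ≡⟨ cong (_+ ∑ (λ s → G (c + s)) U) (∑-zero G c G<c≡0) ⟩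
    ∑ (λ s → G (c + s)) U             ∎
  where open ≡-Reasoning

χ : ∀ {a} {A : Set a} → Dec A → ℕ
χ d = if does d then 1 else 0

χ-yes : ∀ {a} {A : Set a} (d : Dec A) → A → χ d ≡ 1
χ-yes (yes _) _ = refl
χ-yes (no ¬x) x = ⊥-elim (¬x x)

χ-no : ∀ {a} {A : Set a} (d : Dec A) → ¬ A → χ d ≡ 0
χ-no (yes x) ¬x = ⊥-elim (¬x x)
χ-no (no _)  _  = refl

χ-×-dec : ∀ {a b} {A : Set a} {B : Set b} (d : Dec A) (e : Dec B) → χ (d ×-dec e) ≡ χ d * χ e
χ-×-dec d e with does d | does e
... | true  | true  = refl
... | true  | false = refl
... | false | _     = refl

χ-cong : ∀ {a b} {A : Set a} {B : Set b} → (A → B) → (B → A) → (d : Dec A) (e : Dec B) → χ d ≡ χ e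
χ-cong f g (yes x) (yes y) = refl
χ-cong f g (yes x) (no ¬y) = ⊥-elim (¬y (f x))
χ-cong f g (no ¬x) (yes y) = ⊥-elim (¬x (g y))
χ-cong f g (no ¬x) (no ¬y) = refl

χ-<-suc : ∀ a b → χ (a <? suc b) ≡ χ (a <? b) + χ (b ≟ a)
χ-<-suc a b with <-cmp a b
... | tri< a<b _ _ = trans (χ-yes (a <? suc b) (m<n⇒m<1+n a<b))
                           (sym (cong₂ _+_ (χ-yes (a <? b) a<b) (χ-no (b ≟ a) (λ b≡a → <-irrefl (sym b≡a) a<b))))
... | tri≈ _ refl _ = trans (χ-yes (a <? suc a) ≤-refl)
                            (sym (cong₂ _+_ (χ-no (a <? a) (<-irrefl refl)) (χ-yes (a ≟ a) refl)))
... | tri> _ _ b<a = trans (χ-no (a <? suc b) (λ a≤b → <-irrefl refl (≤-trans (s≤s b<a) a≤b)))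
                           (sym (cong₂ _+_ (χ-no (a <? b) (λ a<b → <-asym a<b b<a)) (χ-no (b ≟ a) (λ b≡a → <-irrefl b≡a b<a))))

∑-χ-≟ : ∀ r M → ∑ (λ i → χ (r ≟ i)) M ≡ χ (r <? M)
∑-χ-≟ r zero    = refl
∑-χ-≟ r (suc M) = begin
    ∑ (λ i → χ (r ≟ i)) (suc M)               ≡⟨ ∑-suc (λ i → χ (r ≟ i)) M ⟩
    ∑ (λ i → χ (r ≟ i)) M + χ (r ≟ M)         ≡⟨ cong₂ _+_ (∑-χ-≟ r M) (χ-cong sym sym (r ≟ M) (M ≟ r)) ⟩
    χ (r <? M) + χ (M ≟ r)                    ≡⟨ χ-<-suc r M ⟨
    χ (r <? suc M)                            ∎
  where open ≡-Reasoning

∑-χ-≟-point : ∀ (F : ℕ → ℕ) t N → t < N → ∑ (λ b → χ (b ≟ t) * F b) N ≡ F t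
∑-χ-≟-point F t N t<N = begin
    ∑ (λ b → χ (b ≟ t) * F b) N     ≡⟨ ∑-cong N (λ b → cong (_* F b) (χ-cong sym sym (b ≟ t) (t ≟ b))) ⟩
    ∑ (λ b → χ (t ≟ b) * F b) N     ≡⟨ ∑-cong N (λ b → χ-≟-* b) ⟩
    ∑ (λ b → χ (t ≟ b) * F t) N     ≡⟨ ∑-cong N (λ b → *-comm (χ (t ≟ b)) (F t)) ⟩
    ∑ (λ b → F t * χ (t ≟ b)) N     ≡⟨ ∑-distribˡ-* (F t) (λ b → χ (t ≟ b)) N ⟩
    F t * ∑ (λ b → χ (t ≟ b)) N     ≡⟨ cong (F t *_) (trans (∑-χ-≟ t N) (χ-yes (t <? N) t<N)) ⟩
    F t * 1                         ≡⟨ *-identityʳ (F t) ⟩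
    F t                             ∎
  where
  open ≡-Reasoning
  χ-≟-* : ∀ b → χ (t ≟ b) * F b ≡ χ (t ≟ b) * F t
  χ-≟-* b = χ-*-subst (t ≟ b)
    where
    χ-*-subst : ∀ {b} (t≟b : Dec (t ≡ b)) → χ t≟b * F b ≡ χ t≟b * F t
    χ-*-subst (yes refl) = refl
    χ-*-subst (no _)     = refl

∑-χ-<-truncate : ∀ (g : ℕ → ℕ) y N → y ≤ N → ∑ (λ s → χ (s <? y) * g s) N ≡ ∑ g y
∑-χ-<-truncate g y N y≤N = begin
    ∑ (λ s → χ (s <? y) * g s) N
  ≡⟨ cong (∑ _) (m+[n∸m]≡n y≤N) ⟨
    ∑ (λ s → χ (s <? y) * g s) (y + (N ∸ y))
  ≡⟨ ∑-split _ y (N ∸ y) ⟩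
    ∑ (λ s → χ (s <? y) * g s) y + ∑ (λ u → χ (y + u <? y) * g (y + u)) (N ∸ y)
  ≡⟨ cong₂ _+_ (∑-cong< y (λ s s<y → trans (cong (_* g s) (χ-yes (s <? y) s<y)) (+-identityʳ (g s))))
               (∑-zero _ (N ∸ y) (λ u _ → cong (_* g (y + u)) (χ-no (y + u <? y) (λ lt → m+n≮m y u lt)))) ⟩
    ∑ g y + 0
  ≡⟨ +-identityʳ _ ⟩
    ∑ g y
  ∎
  where open ≡-Reasoning

∑ₗ : ∀ {T : Set} → (T → ℕ) → List T → ℕ
∑ₗ w []       = 0
∑ₗ w (x ∷ xs) = w x + ∑ₗ w xs

module _ {T : Set} where

  length≡∑ₗ-1 : (xs : List T) → length xs ≡ ∑ₗ (λ _ → 1) xs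
  length≡∑ₗ-1 []       = refl
  length≡∑ₗ-1 (x ∷ xs) = cong suc (length≡∑ₗ-1 xs)

  length-filter≡∑ₗ-χ : ∀ {p} {P : T → Set p} (P? : ∀ t → Dec (P t)) xs →
                       length (filter P? xs) ≡ ∑ₗ (χ ∘ P?) xs
  length-filter≡∑ₗ-χ P? []       = refl
  length-filter≡∑ₗ-χ P? (x ∷ xs) with does (P? x)
  ... | true  = cong suc (length-filter≡∑ₗ-χ P? xs)
  ... | false = length-filter≡∑ₗ-χ P? xs

  ∑ₗ-filter : ∀ {p} {P : T → Set p} (P? : ∀ t → Dec (P t)) (w : T → ℕ) xs →
              ∑ₗ w (filter P? xs) ≡ ∑ₗ (λ t → χ (P? t) * w t) xs
  ∑ₗ-filter P? w []       = refl
  ∑ₗ-filter P? w (x ∷ xs) with does (P? x)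
  ... | true  = cong₂ _+_ (sym (+-identityʳ (w x))) (∑ₗ-filter P? w xs)
  ... | false = ∑ₗ-filter P? w xs

  ∑ₗ-++ : ∀ (w : T → ℕ) xs ys → ∑ₗ w (xs ++ ys) ≡ ∑ₗ w xs + ∑ₗ w ys
  ∑ₗ-++ w []       ys = refl
  ∑ₗ-++ w (x ∷ xs) ys = trans (cong (w x +_) (∑ₗ-++ w xs ys)) (sym (+-assoc (w x) _ _))

  ∑ₗ-cong : ∀ {w v : T → ℕ} xs → (∀ t → w t ≡ v t) → ∑ₗ w xs ≡ ∑ₗ v xs
  ∑ₗ-cong []       w≡v = refl
  ∑ₗ-cong (x ∷ xs) w≡v = cong₂ _+_ (w≡v x) (∑ₗ-cong xs w≡v)

  ∑ₗ-applyUpTo : ∀ (w : T → ℕ) (g : ℕ → T) N → ∑ₗ w (applyUpTo g N) ≡ ∑ (w ∘ g) N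
  ∑ₗ-applyUpTo w g zero    = refl
  ∑ₗ-applyUpTo w g (suc N) = cong (w (g 0) +_) (∑ₗ-applyUpTo w (g ∘ suc) N)

  ∑-∑ₗ : ∀ (w : ℕ → T → ℕ) N xs → ∑ (λ i → ∑ₗ (w i) xs) N ≡ ∑ₗ (λ x → ∑ (λ i → w i x) N) xs
  ∑-∑ₗ w N []       = ∑-zero _ N (λ _ _ → refl)
  ∑-∑ₗ w N (x ∷ xs) = trans (∑-distrib-+ (λ i → w i x) (λ i → ∑ₗ (w i) xs) N)
                            (cong (∑ (λ i → w i x) N +_) (∑-∑ₗ w N xs))

∑ₗ-map : ∀ {S T : Set} (w : T → ℕ) (h : S → T) xs → ∑ₗ w (map h xs) ≡ ∑ₗ (w ∘ h) xs
∑ₗ-map w h []       = refl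
∑ₗ-map w h (x ∷ xs) = cong (w (h x) +_) (∑ₗ-map w h xs)

∑ₗ-concatMap : ∀ {S T : Set} (w : T → ℕ) (g : S → List T) xs →
               ∑ₗ w (concatMap g xs) ≡ ∑ₗ (∑ₗ w ∘ g) xs
∑ₗ-concatMap w g []       = refl
∑ₗ-concatMap w g (x ∷ xs) = trans (∑ₗ-++ w (g x) _) (cong (∑ₗ w (g x) +_) (∑ₗ-concatMap w g xs))

∑ₗ-candidates : ∀ (w : Triple → ℕ) n →
  ∑ₗ w (candidates n) ≡ ∑ (λ a → ∑ (λ b → ∑ (λ c → w (a , b , c)) (suc n)) (suc n)) (suc n)
∑ₗ-candidates w n =
  trans (∑ₗ-concatMap w row U)
   (trans (∑ₗ-applyUpTo (∑ₗ w ∘ row) (λ a → a) (suc n))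
    (∑-cong (suc n) λ a →
      trans (∑ₗ-concatMap w (column a) U)
       (trans (∑ₗ-applyUpTo (∑ₗ w ∘ column a) (λ b → b) (suc n))
        (∑-cong (suc n) λ b →
          trans (∑ₗ-map w (λ c → (a , b , c)) U) (∑ₗ-applyUpTo (λ c → w (a , b , c)) (λ c → c) (suc n))))))
  where
  U = upTo (suc n)
  column : ℕ → ℕ → List Triple
  column a b = map (λ c → (a , b , c)) U
  row : ℕ → List Triple
  row a = concatMap (column a) U

upperHalf : (ℕ → ℕ) → ℕ → ℕ
upperHalf φ K = ∑ (λ s → χ (K ≤? s + s) * φ s) (suc K)

module PartitionSums (n : ℕ) where

  isPartition3? : ∀ t → Dec (IsPartition3 n t)
  isPartition3? t = (λ₁ t + λ₂ t + λ₃ t ≟ n) ×-dec (λ₂ t ≤? λ₁ t) ×-dec (λ₃ t ≤? λ₂ t) ×-dec (1 ≤? λ₃ t)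

  partition? : ∀ a b c → Dec (IsPartition3 n (a , b , c))
  partition? a b c = isPartition3? (a , b , c)

  ∑P : (ℕ → ℕ) → ℕ
  ∑P φ = ∑ (λ a → ∑ (λ b → ∑ (λ c → χ (partition? a b c) * φ (a ∸ c)) (suc n)) (suc n)) (suc n)

  middle : ℕ → ℕ → ℕ
  middle a c = n ∸ (a + c)

  partition⇒middle : ∀ a b c → IsPartition3 n (a , b , c) →
                     (b ≡ middle a c) × IsPartition3 n (a , middle a c , c)
  partition⇒middle a b c p@(sum≡n , _) = b≡middle , subst (λ b → IsPartition3 n (a , b , c)) b≡middle p
    where
    swap : ∀ a b c → a + b + c ≡ a + c + b
    swap = solve-∀
    b≡middle : b ≡ middle a c
    b≡middle = sym (trans (cong (_∸ (a + c)) (trans (sym sum≡n) (swap a b c))) (m+n∸m≡n (a + c) b))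

  ∑-over-λ₂ : ∀ (φ : ℕ → ℕ) a c →
              ∑ (λ b → χ (partition? a b c) * φ (a ∸ c)) (suc n) ≡ χ (partition? a (middle a c) c) * φ (a ∸ c)
  ∑-over-λ₂ φ a c = trans (∑-cong (suc n) split) (∑-χ-≟-point (λ _ → w) (middle a c) (suc n) (s≤s (m∸n≤m n (a + c))))
    where
    w = χ (partition? a (middle a c) c) * φ (a ∸ c)
    split : ∀ b → χ (partition? a b c) * φ (a ∸ c) ≡ χ (b ≟ middle a c) * w
    split b = begin
        χ (partition? a b c) * φ (a ∸ c)
      ≡⟨ cong (_* φ (a ∸ c)) (χ-cong (partition⇒middle a b c)
           (λ (b≡ , p) → subst (λ b → IsPartition3 n (a , b , c)) (sym b≡) p)
           (partition? a b c) ((b ≟ middle a c) ×-dec partition? a (middle a c) c)) ⟩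
        χ ((b ≟ middle a c) ×-dec partition? a (middle a c) c) * φ (a ∸ c)
      ≡⟨ cong (_* φ (a ∸ c)) (χ-×-dec (b ≟ middle a c) (partition? a (middle a c) c)) ⟩
        χ (b ≟ middle a c) * χ (partition? a (middle a c) c) * φ (a ∸ c)
      ≡⟨ *-assoc (χ (b ≟ middle a c)) _ _ ⟩
        χ (b ≟ middle a c) * w
      ∎
      where open ≡-Reasoning

  ∑-over-λ₁ : ∀ (φ : ℕ → ℕ) c →
    ∑ (λ a → χ (partition? a (middle a c) c) * φ (a ∸ c)) (suc n) ≡
    ∑ (λ s → χ (partition? (c + s) (middle (c + s) c) c) * φ s) (suc n)
  ∑-over-λ₁ φ c = trans (∑-shift G c (suc n) vanish-below vanish-above)
                        (∑-cong (suc n) (λ s → cong (λ d → χ (partition? (c + s) (middle (c + s) c) c) * φ d) (m+n∸m≡n c s)))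
    where
    G : ℕ → ℕ
    G a = χ (partition? a (middle a c) c) * φ (a ∸ c)
    vanish-below : ∀ a → a < c → G a ≡ 0
    vanish-below a a<c = cong (_* φ (a ∸ c)) (χ-no (partition? a (middle a c) c)
      (λ (_ , mid≤a , c≤mid , _) → <-irrefl refl (<-≤-trans a<c (≤-trans c≤mid mid≤a))))
    vanish-above : ∀ a → suc n ≤ a → G a ≡ 0
    vanish-above a n<a = cong (_* φ (a ∸ c)) (χ-no (partition? a (middle a c) c)
      (λ (sum≡n , _) → <-irrefl refl (≤-trans n<a (≤-trans (m≤m+n a _) (≤-trans (m≤m+n (a + _) c) (≤-reflexive sum≡n))))))

  remainder : ℕ → ℕ
  remainder c = n ∸ c * 3

  ValidSmallest : ℕ → Set
  ValidSmallest c = (1 ≤ c) × (c * 3 ≤ n)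

  validSmallest? : ∀ c → Dec (ValidSmallest c)
  validSmallest? c = (1 ≤? c) ×-dec (c * 3 ≤? n)

  InUpperHalf : ℕ → ℕ → Set
  InUpperHalf K s = (s < suc K) × (K ≤ s + s)

  inUpperHalf? : ∀ K s → Dec (InUpperHalf K s)
  inUpperHalf? K s = (s <? suc K) ×-dec (K ≤? s + s)

  partition⇒upperHalf : ∀ c s → IsPartition3 n (c + s , middle (c + s) c , c) →
                        ValidSmallest c × InUpperHalf (remainder c) s
  partition⇒upperHalf c s (sum≡n , mid≤a , c≤mid , 1≤c) = (1≤c , 3c≤n) , s≤s s≤K , K≤2s
    where
    e₁ : ∀ c → c * 3 ≡ c + c + c
    e₁ = solve-∀
    e₂ : ∀ c s → s + c * 3 ≡ c + s + c + c
    e₂ = solve-∀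
    e₃ : ∀ c s → c + s + (c + s) + c ≡ c * 3 + (s + s)
    e₃ = solve-∀
    3c≤n : c * 3 ≤ n
    3c≤n = ≤-trans (≤-reflexive (e₁ c)) (≤-trans (+-mono-≤ (+-mono-≤ (m≤m+n c s) c≤mid) ≤-refl) (≤-reflexive sum≡n))
    s≤K : s ≤ remainder c
    s≤K = m+n≤o⇒m≤o∸n s (≤-trans (≤-reflexive (e₂ c s)) (≤-trans (+-mono-≤ (+-monoʳ-≤ (c + s) c≤mid) ≤-refl) (≤-reflexive sum≡n)))
    K≤2s : remainder c ≤ s + s
    K≤2s = m≤n+o⇒m∸n≤o n (c * 3) (≤-trans (≤-reflexive (sym sum≡n)) (≤-trans (+-mono-≤ (+-monoʳ-≤ (c + s) mid≤a) ≤-refl) (≤-reflexive (e₃ c s))))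

  upperHalf⇒partition : ∀ c s → ValidSmallest c × InUpperHalf (remainder c) s →
                        IsPartition3 n (c + s , middle (c + s) c , c)
  upperHalf⇒partition c s ((1≤c , 3c≤n) , s<K+1 , K≤2s) = sum≡n , mid≤a , c≤mid , 1≤c
    where
    a = c + s
    e₁ : ∀ c s → c + s + c + c ≡ s + c * 3
    e₁ = solve-∀
    e₂ : ∀ a t c → a + t + c ≡ a + c + t
    e₂ = solve-∀
    e₃ : ∀ c s → s + s + c * 3 ≡ c + s + c + (c + s)
    e₃ = solve-∀
    e₄ : ∀ c s → c + (c + s + c) ≡ s + c * 3
    e₄ = solve-∀
    s+3c≤n : s + c * 3 ≤ n
    s+3c≤n = m≤o∸n⇒m+n≤o s 3c≤n (s≤s⁻¹ s<K+1)
    n≤2s+3c : n ≤ (s + s) + c * 3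
    n≤2s+3c = ≤-trans (≤-reflexive (sym (m∸n+n≡m 3c≤n))) (+-monoˡ-≤ (c * 3) K≤2s)
    a+c≤n : a + c ≤ n
    a+c≤n = ≤-trans (≤-trans (m≤m+n (a + c) c) (≤-reflexive (e₁ c s))) s+3c≤n
    sum≡n : a + middle a c + c ≡ n
    sum≡n = trans (e₂ a (middle a c) c) (m+[n∸m]≡n a+c≤n)
    mid≤a : middle a c ≤ a
    mid≤a = m≤n+o⇒m∸n≤o n (a + c) (≤-trans n≤2s+3c (≤-reflexive (e₃ c s)))
    c≤mid : c ≤ middle a c
    c≤mid = m+n≤o⇒m≤o∸n c (≤-trans (≤-reflexive (e₄ c s)) s+3c≤n)

  ∑-over-difference : ∀ (φ : ℕ → ℕ) c →
    ∑ (λ s → χ (partition? (c + s) (middle (c + s) c) c) * φ s) (suc n) ≡ χ (validSmallest? c) * upperHalf φ (remainder c)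
  ∑-over-difference φ c = begin
      ∑ (λ s → χ (partition? (c + s) (middle (c + s) c) c) * φ s) (suc n)
    ≡⟨ ∑-cong (suc n) (λ s → trans (cong (_* φ s) (χ-factor s)) (reassoc (χ V) (χ (s <? suc K)) (χ (K ≤? s + s)) (φ s))) ⟩
      ∑ (λ s → χ V * (χ (s <? suc K) * (χ (K ≤? s + s) * φ s))) (suc n)
    ≡⟨ ∑-distribˡ-* (χ V) (λ s → χ (s <? suc K) * (χ (K ≤? s + s) * φ s)) (suc n) ⟩
      χ V * ∑ (λ s → χ (s <? suc K) * (χ (K ≤? s + s) * φ s)) (suc n)
    ≡⟨ cong (χ V *_) (∑-χ-<-truncate (λ s → χ (K ≤? s + s) * φ s) (suc K) (suc n) (s≤s (m∸n≤m n (c * 3)))) ⟩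
      χ V * upperHalf φ K
    ∎
    where
    open ≡-Reasoning
    K = remainder c
    V = validSmallest? c
    reassoc : ∀ x y z w → x * (y * z) * w ≡ x * (y * (z * w))
    reassoc = solve-∀
    χ-factor : ∀ s → χ (partition? (c + s) (middle (c + s) c) c) ≡ χ V * (χ (s <? suc K) * χ (K ≤? s + s))
    χ-factor s = trans (χ-cong (partition⇒upperHalf c s) (upperHalf⇒partition c s) (partition? (c + s) (middle (c + s) c) c) (V ×-dec inUpperHalf? K s))
                       (trans (χ-×-dec V (inUpperHalf? K s)) (cong (χ V *_) (χ-×-dec (s <? suc K) (K ≤? s + s))))

  ∑-over-λ₃ : ∀ (g : ℕ → ℕ) → ∑ (λ c → χ (validSmallest? c) * g (remainder c)) (suc n) ≡ ∑ (λ u → g (remainder (suc u))) (n / 3)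
  ∑-over-λ₃ g = trans (∑-cong n (λ u → cong (_* g (remainder (suc u)))
                        (χ-cong (λ (_ , 3c≤n) → ≤-trans (≤-reflexive (sym (m*n/n≡m (suc u) 3))) (/-monoˡ-≤ 3 3c≤n))
                                (λ u<n/3 → z<s , ≤-trans (*-monoˡ-≤ 3 u<n/3) (m/n*n≤m n 3))
                                (validSmallest? (suc u)) (u <? n / 3))))
                      (∑-χ-<-truncate (λ u → g (remainder (suc u))) (n / 3) n (m/n≤m n 3))

  ∑-remainders : ∀ (g : ℕ → ℕ) → ∑ (λ u → g (remainder (suc u))) (n / 3) ≡ ∑ (λ u → g (n % 3 + 3 * u)) (n / 3)
  ∑-remainders g = trans (∑-cong< (n / 3) (λ u u<N → cong g (remainder≡ u u<N))) (∑-reverse (λ u → g (n % 3 + 3 * u)) (n / 3))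
    where
    e : ∀ r d v → r + (d + v) * 3 ≡ r + 3 * d + v * 3
    e = solve-∀
    remainder≡ : ∀ u → u < n / 3 → remainder (suc u) ≡ n % 3 + 3 * (n / 3 ∸ suc u)
    remainder≡ u u<N = trans (cong (_∸ suc u * 3) n≡) (m+n∸n≡m (n % 3 + 3 * (n / 3 ∸ suc u)) (suc u * 3))
      where
      n≡ : n ≡ n % 3 + 3 * (n / 3 ∸ suc u) + suc u * 3
      n≡ = trans (m≡m%n+[m/n]*n n 3) (trans (cong (λ q → n % 3 + q * 3) (sym (m∸n+n≡m u<N))) (e (n % 3) (n / 3 ∸ suc u) (suc u)))

  ∑P≡∑-upperHalf : ∀ φ → ∑P φ ≡ ∑ (λ u → upperHalf φ (n % 3 + 3 * u)) (n / 3)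
  ∑P≡∑-upperHalf φ = begin
      ∑P φ
    ≡⟨ ∑-cong (suc n) (λ a → ∑-comm (λ b c → χ (partition? a b c) * φ (a ∸ c)) (suc n) (suc n)) ⟩
      ∑ (λ a → ∑ (λ c → ∑ (λ b → χ (partition? a b c) * φ (a ∸ c)) (suc n)) (suc n)) (suc n)
    ≡⟨ ∑-comm (λ a c → ∑ (λ b → χ (partition? a b c) * φ (a ∸ c)) (suc n)) (suc n) (suc n) ⟩
      ∑ (λ c → ∑ (λ a → ∑ (λ b → χ (partition? a b c) * φ (a ∸ c)) (suc n)) (suc n)) (suc n)
    ≡⟨ ∑-cong (suc n) (λ c → trans (∑-cong (suc n) (λ a → ∑-over-λ₂ φ a c)) (trans (∑-over-λ₁ φ c) (∑-over-difference φ c))) ⟩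
      ∑ (λ c → χ (validSmallest? c) * upperHalf φ (remainder c)) (suc n)
    ≡⟨ ∑-over-λ₃ (upperHalf φ) ⟩
      ∑ (λ u → upperHalf φ (remainder (suc u))) (n / 3)
    ≡⟨ ∑-remainders (upperHalf φ) ⟩
      ∑ (λ u → upperHalf φ (n % 3 + 3 * u)) (n / 3)
    ∎
    where open ≡-Reasoning

upperHalf-+-∑ : ∀ (φ : ℕ → ℕ) K → upperHalf φ K + ∑ φ (suc K / 2) ≡ ∑ φ (suc K)
upperHalf-+-∑ φ K = sym (begin
    ∑ φ (suc K)
  ≡⟨ ∑-cong (suc K) split ⟩
    ∑ (λ s → χ (K ≤? s + s) * φ s + χ (s <? suc K / 2) * φ s) (suc K)
  ≡⟨ ∑-distrib-+ (λ s → χ (K ≤? s + s) * φ s) (λ s → χ (s <? suc K / 2) * φ s) (suc K) ⟩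
    upperHalf φ K + ∑ (λ s → χ (s <? suc K / 2) * φ s) (suc K)
  ≡⟨ cong (upperHalf φ K +_) (∑-χ-<-truncate φ (suc K / 2) (suc K) (m/n≤m (suc K) 2)) ⟩
    upperHalf φ K + ∑ φ (suc K / 2)
  ∎)
  where
  open ≡-Reasoning
  e : ∀ s → suc (suc (s + s)) ≡ suc s * 2
  e = solve-∀
  half≤ : ∀ s → K ≤ s + s → suc K / 2 ≤ s
  half≤ s K≤2s = s≤s⁻¹ (m<n*o⇒m/o<n (≤-trans (s≤s (s≤s K≤2s)) (≤-reflexive (e s))))
  <half : ∀ s → s + s < K → s < suc K / 2
  <half s 2s<K = ≤-trans (≤-reflexive (sym (m*n/n≡m (suc s) 2))) (/-monoˡ-≤ 2 (≤-trans (≤-reflexive (sym (e s))) (s≤s 2s<K)))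
  χ-dichotomy : ∀ s (K≤?2s : Dec (K ≤ s + s)) → χ K≤?2s + χ (s <? suc K / 2) ≡ 1
  χ-dichotomy s (yes K≤2s) = cong (1 +_) (χ-no (s <? suc K / 2) (λ s<h → <-irrefl refl (<-≤-trans s<h (half≤ s K≤2s))))
  χ-dichotomy s (no  K≰2s) = cong (0 +_) (χ-yes (s <? suc K / 2) (<half s (≰⇒> K≰2s)))
  split : ∀ s → φ s ≡ χ (K ≤? s + s) * φ s + χ (s <? suc K / 2) * φ s
  split s = sym (trans (sym (*-distribʳ-+ (φ s) (χ (K ≤? s + s)) (χ (s <? suc K / 2))))
                       (trans (cong (_* φ s) (χ-dichotomy s (K ≤? s + s))) (+-identityʳ (φ s))))

divMod-unique : ∀ {d} .{{_ : NonZero d}} r q → r < d → ((r + q * d) % d ≡ r) × ((r + q * d) / d ≡ q)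
divMod-unique {d} r q r<d =
  trans ([m+kn]%n≡m%n r q d) (m<n⇒m%n≡m r<d) ,
  trans (+-distrib-/-∣ʳ r (divides q refl)) (cong₂ _+_ (m<n⇒m/n≡0 r<d) (m*n/n≡m q d))

module Crank (m : ℕ) .{{_ : NonZero m}} where

  inClass : ℕ → ℕ → ℕ
  inClass i s = χ (s % m ≟ i % m)

  crankCount≡∑P : ∀ n i → crankCount m n i ≡ PartitionSums.∑P n (inClass i)
  crankCount≡∑P n i =
    trans (length-filter≡∑ₗ-χ crank? (P3 n))
     (trans (∑ₗ-filter isPartition3? (χ ∘ crank?) (candidates n))
            (∑ₗ-candidates (λ t → χ (isPartition3? t) * χ (crank? t)) n))
    where
    open PartitionSums n using (isPartition3?)
    crank? : ∀ t → Dec ((λ₁ t ∸ λ₃ t) % m ≡ i % m)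
    crank? t = (λ₁ t ∸ λ₃ t) % m ≟ i % m

  p3≡∑-crankCount : ∀ n → p3 n ≡ ∑ (crankCount m n) m
  p3≡∑-crankCount n = sym (begin
      ∑ (crankCount m n) m
    ≡⟨ ∑-cong m (λ i → length-filter≡∑ₗ-χ (crank? i) (P3 n)) ⟩
      ∑ (λ i → ∑ₗ (χ ∘ crank? i) (P3 n)) m
    ≡⟨ ∑-∑ₗ (λ i → χ ∘ crank? i) m (P3 n) ⟩
      ∑ₗ (λ t → ∑ (λ i → χ (crank? i t)) m) (P3 n)
    ≡⟨ ∑ₗ-cong (P3 n) exactlyOneClass ⟩
      ∑ₗ (λ _ → 1) (P3 n)
    ≡⟨ length≡∑ₗ-1 (P3 n) ⟨
      p3 n
    ∎)
    where
    open ≡-Reasoning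
    crank? : ∀ i t → Dec ((λ₁ t ∸ λ₃ t) % m ≡ i % m)
    crank? i t = (λ₁ t ∸ λ₃ t) % m ≟ i % m
    exactlyOneClass : ∀ t → ∑ (λ i → χ (crank? i t)) m ≡ 1
    exactlyOneClass t =
      trans (∑-cong< m (λ i i<m → cong (λ i′ → χ (r ≟ i′)) (m<n⇒m%n≡m i<m)))
            (trans (∑-χ-≟ r m) (χ-yes (r <? m) (m%n<n (λ₁ t ∸ λ₃ t) m)))
      where r = (λ₁ t ∸ λ₃ t) % m

  ∑-inClass : ∀ i y → ∑ (inClass i) y ≡ y / m + χ (i % m <? y % m)
  ∑-inClass i zero    = sym (cong₂ (λ q r → q + χ (i % m <? r)) (0/n≡0 m) (m<n⇒m%n≡m (>-nonZero⁻¹ m)))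
  ∑-inClass i (suc y) = begin
      ∑ (inClass i) (suc y)
    ≡⟨ ∑-suc (inClass i) y ⟩
      ∑ (inClass i) y + inClass i y
    ≡⟨ cong (_+ inClass i y) (∑-inClass i y) ⟩
      y / m + χ (i % m <? y % m) + χ (y % m ≟ i % m)
    ≡⟨ +-assoc (y / m) _ _ ⟩
      y / m + (χ (i % m <? y % m) + χ (y % m ≟ i % m))
    ≡⟨ cong (y / m +_) (χ-<-suc (i % m) (y % m)) ⟨
      y / m + χ (i % m <? suc (y % m))
    ≡⟨ carry (<-cmp (suc (y % m)) m) ⟩
      suc y / m + χ (i % m <? suc y % m)
    ∎
    where
    open ≡-Reasoning
    y≡ : suc y ≡ suc (y % m) + y / m * m
    y≡ = cong suc (m≡m%n+[m/n]*n y m)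
    carry : Tri (suc (y % m) < m) (suc (y % m) ≡ m) (m < suc (y % m)) →
            y / m + χ (i % m <? suc (y % m)) ≡ suc y / m + χ (i % m <? suc y % m)
    carry (tri< no-wrap _ _) =
      let (mod≡ , div≡) = divMod-unique (suc (y % m)) (y / m) no-wrap
      in sym (cong₂ (λ q r → q + χ (i % m <? r)) (trans (cong (_/ m) y≡) div≡) (trans (cong (_% m) y≡) mod≡))
    carry (tri≈ _ wrap _) = begin
        y / m + χ (i % m <? suc (y % m))   ≡⟨ cong (y / m +_) (χ-yes (i % m <? suc (y % m)) (subst (i % m <_) (sym wrap) (m%n<n i m))) ⟩
        y / m + 1                          ≡⟨ +-comm (y / m) 1 ⟩
        suc (y / m)                        ≡⟨ trans (cong (_/ m) y≡′) div≡ ⟨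
        suc y / m                          ≡⟨ +-identityʳ _ ⟨
        suc y / m + 0                      ≡⟨ cong (λ r → suc y / m + χ (i % m <? r)) (trans (cong (_% m) y≡′) mod≡) ⟨
        suc y / m + χ (i % m <? suc y % m) ∎
      where
      y≡′ : suc y ≡ 0 + suc (y / m) * m
      y≡′ = trans y≡ (cong (_+ y / m * m) wrap)
      mod≡ = proj₁ (divMod-unique 0 (suc (y / m)) (>-nonZero⁻¹ m))
      div≡ = proj₂ (divMod-unique 0 (suc (y / m)) (>-nonZero⁻¹ m))
    carry (tri> _ _ overflow) = ⊥-elim (<-irrefl refl (≤-trans overflow (m%n<n y m)))

  -- The residues mod m of k = ρ + 3u + 1 and of ⌊k/2⌋, for u < N, agree as multisets.
  Balanced : ℕ → ℕ → Set
  Balanced ρ N = ∀ (h : ℕ → ℕ) → ∑ (λ u → h (suc (ρ + 3 * u) % m)) N ≡ ∑ (λ u → h ((suc (ρ + 3 * u) / 2) % m)) N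

  crankCount-+-∑-quotients : ∀ n i → Balanced (n % 3) (n / 3) →
    crankCount m n i + ∑ (λ u → (suc (n % 3 + 3 * u) / 2) / m) (n / 3) ≡ ∑ (λ u → suc (n % 3 + 3 * u) / m) (n / 3)
  crankCount-+-∑-quotients n i balanced = +-cancelʳ-≡ (∑ (λ u → h ((k u / 2) % m)) N) _ _ (begin
      crankCount m n i + ∑ (λ u → (k u / 2) / m) N + ∑ (λ u → h ((k u / 2) % m)) N
    ≡⟨ +-assoc (crankCount m n i) _ _ ⟩
      crankCount m n i + (∑ (λ u → (k u / 2) / m) N + ∑ (λ u → h ((k u / 2) % m)) N)
    ≡⟨ cong₂ _+_ (trans (crankCount≡∑P n i) (PartitionSums.∑P≡∑-upperHalf n (inClass i)))
                 (sym (∑-distrib-+ (λ u → (k u / 2) / m) (λ u → h ((k u / 2) % m)) N)) ⟩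
      ∑ (λ u → upperHalf (inClass i) (ρ + 3 * u)) N + ∑ (λ u → (k u / 2) / m + h ((k u / 2) % m)) N
    ≡⟨ cong (∑ (λ u → upperHalf (inClass i) (ρ + 3 * u)) N +_) (∑-cong N (λ u → ∑-inClass i (k u / 2))) ⟨
      ∑ (λ u → upperHalf (inClass i) (ρ + 3 * u)) N + ∑ (λ u → ∑ (inClass i) (k u / 2)) N
    ≡⟨ ∑-distrib-+ (λ u → upperHalf (inClass i) (ρ + 3 * u)) (λ u → ∑ (inClass i) (k u / 2)) N ⟨
      ∑ (λ u → upperHalf (inClass i) (ρ + 3 * u) + ∑ (inClass i) (k u / 2)) N
    ≡⟨ ∑-cong N (λ u → trans (upperHalf-+-∑ (inClass i) (ρ + 3 * u)) (∑-inClass i (k u))) ⟩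
      ∑ (λ u → k u / m + h (k u % m)) N
    ≡⟨ ∑-distrib-+ (λ u → k u / m) (λ u → h (k u % m)) N ⟩
      ∑ (λ u → k u / m) N + ∑ (λ u → h (k u % m)) N
    ≡⟨ cong (∑ (λ u → k u / m) N +_) (balanced h) ⟩
      ∑ (λ u → k u / m) N + ∑ (λ u → h ((k u / 2) % m)) N
    ∎)
    where
    open ≡-Reasoning
    ρ = n % 3
    N = n / 3
    k : ℕ → ℕ
    k u = suc (ρ + 3 * u)
    h : ℕ → ℕ
    h r = χ (i % m <? r)

  crankCount≡p3/m : ∀ n i → Balanced (n % 3) (n / 3) → crankCount m n i ≡ p3 n / m
  crankCount≡p3/m n i balanced = sym (begin
      p3 n / m                           ≡⟨ cong (_/ m) (p3≡∑-crankCount n) ⟩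
      ∑ (crankCount m n) m / m           ≡⟨ cong (_/ m) (∑-cong m independent) ⟩
      ∑ (λ _ → crankCount m n i) m / m   ≡⟨ cong (_/ m) (trans (∑-const (crankCount m n i) m) (*-comm m _)) ⟩
      crankCount m n i * m / m           ≡⟨ m*n/n≡m (crankCount m n i) m ⟩
      crankCount m n i                   ∎)
    where
    open ≡-Reasoning
    independent : ∀ i′ → crankCount m n i′ ≡ crankCount m n i
    independent i′ = +-cancelʳ-≡ _ _ _ (trans (crankCount-+-∑-quotients n i′ balanced)
                                              (sym (crankCount-+-∑-quotients n i balanced)))

module _ (M : ℕ) .{{_ : NonZero M}} where

  congPM-0 : ∀ n → CongPM M n 0 → n % M ≡ 0
  congPM-0 n (inj₁ n≡0)   = trans n≡0 (m<n⇒m%n≡m (>-nonZero⁻¹ M))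
  congPM-0 n (inj₂ n+0≡0) = trans (cong (_% M) (sym (+-identityʳ n))) n+0≡0

  multiple≡M : ∀ q → 0 < q * M → q * M < 2 * M → q * M ≡ M
  multiple≡M zero          ()
  multiple≡M 1             _ _      = +-identityʳ M
  multiple≡M (suc (suc q)) _ q*M<2M = ⊥-elim (<-irrefl refl (<-≤-trans q*M<2M (*-monoˡ-≤ M {2} {suc (suc q)} (s≤s (s≤s z≤n)))))

  congPM-residue : ∀ n a r → 0 < a → 0 < r → r + a ≡ M → CongPM M n a → n % M ≡ a ⊎ n % M ≡ r
  congPM-residue n a r 0<a 0<r r+a≡M (inj₁ n≡a)    = inj₁ (trans n≡a (m<n⇒m%n≡m a<M))
    where a<M = subst (a <_) r+a≡M (m<n+m a 0<r)
  congPM-residue n a r 0<a 0<r r+a≡M (inj₂ n+a≡0) = inj₂ (+-cancelʳ-≡ a _ _ (trans x≡M (sym r+a≡M)))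
    where
    a<M = subst (a <_) r+a≡M (m<n+m a 0<r)
    x = n % M + a
    x%M≡0 : x % M ≡ 0
    x%M≡0 = trans (cong (λ a′ → (n % M + a′) % M) (sym (m<n⇒m%n≡m a<M))) (trans (sym (%-distribˡ-+ n a M)) n+a≡0)
    x≡q*M : x ≡ x / M * M
    x≡q*M = trans (m≡m%n+[m/n]*n x M) (cong (_+ x / M * M) x%M≡0)
    x≡M : x ≡ M
    x≡M = trans x≡q*M (multiple≡M (x / M)
            (subst (0 <_) x≡q*M (<-≤-trans 0<a (m≤n+m a (n % M))))
            (subst (_< 2 * M) x≡q*M (+-mono-< (m%n<n n M) (subst (a <_) (sym (+-identityʳ M)) a<M))))

half-+-6* : ∀ x w → (x + 3 * (w + w)) / 2 ≡ x / 2 + 3 * w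
half-+-6* x w = trans (+-distrib-/-∣ʳ x (divides (3 * w) (e w))) (cong (x / 2 +_) (trans (/-congˡ (e w)) (m*n/n≡m (3 * w) 2)))
  where
  e : ∀ w → 3 * (w + w) ≡ 3 * w * 2
  e = solve-∀

module Balance (j : ℕ) where

  m : ℕ
  m = suc (6 * j)

  open Crank m

  ∑-progression : (ℕ → ℕ) → ℕ → ℕ → ℕ
  ∑-progression h c p = ∑ (λ w → h ((c + 3 * w) % m)) p

  ∑-progression-shift : ∀ h c q (f : ℕ → ℕ) p → (∀ w → f w ≡ c + 3 * w + q * m) →
                        ∑ (λ w → h (f w % m)) p ≡ ∑-progression h c p
  ∑-progression-shift h c q f p f≡ = ∑-cong p (λ w → cong h (trans (cong (_% m) (f≡ w)) ([m+kn]%n≡m%n (c + 3 * w) q m)))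

  ∑-progression-+3 : ∀ h c → ∑-progression h (c + 3) m ≡ ∑-progression h c m
  ∑-progression-+3 h c = +-cancelˡ-≡ (f 0) _ _ (begin
      f 0 + ∑-progression h (c + 3) m
    ≡⟨ cong (f 0 +_) (∑-cong m (λ w → cong (λ x → h (x % m)) (e c w))) ⟩
      ∑ f (suc m)
    ≡⟨ ∑-suc f m ⟩
      ∑ f m + f m
    ≡⟨ cong (λ x → ∑ f m + h x) (trans ([m+kn]%n≡m%n c 3 m) (cong (_% m) (sym (+-identityʳ c)))) ⟩
      ∑ f m + f 0
    ≡⟨ +-comm _ (f 0) ⟩
      f 0 + ∑-progression h c m
    ∎)
    where
    open ≡-Reasoning
    f : ℕ → ℕ
    f w = h ((c + 3 * w) % m)
    e : ∀ c w → c + 3 + 3 * w ≡ c + 3 * suc w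
    e = solve-∀

  ∑-progression-+3* : ∀ h c k → ∑-progression h (c + 3 * k) m ≡ ∑-progression h c m
  ∑-progression-+3* h c zero    = cong (λ c → ∑-progression h c m) (+-identityʳ c)
  ∑-progression-+3* h c (suc k) = begin
      ∑-progression h (c + 3 * suc k) m   ≡⟨ cong (λ c → ∑-progression h c m) (e c k) ⟨
      ∑-progression h (c + 3 * k + 3) m   ≡⟨ ∑-progression-+3 h (c + 3 * k) ⟩
      ∑-progression h (c + 3 * k) m       ≡⟨ ∑-progression-+3* h c k ⟩
      ∑-progression h c m                 ∎
    where
    open ≡-Reasoning
    e : ∀ c k → c + 3 * k + 3 ≡ c + 3 * suc k
    e = solve-∀

  -- 3 is invertible mod m = 6j + 1: c + 1 + 3·(2j) = c + m.
  ∑-progression-const : ∀ h c → ∑-progression h c m ≡ ∑-progression h 0 m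
  ∑-progression-const h zero    = refl
  ∑-progression-const h (suc c) = begin
      ∑-progression h (suc c) m             ≡⟨ ∑-progression-+3* h (suc c) (2 * j) ⟨
      ∑-progression h (suc c + 3 * (2 * j)) m ≡⟨ ∑-progression-shift h c 1 (λ w → suc c + 3 * (2 * j) + 3 * w) m (e c j) ⟩
      ∑-progression h c m                   ≡⟨ ∑-progression-const h c ⟩
      ∑-progression h 0 m                   ∎
    where
    open ≡-Reasoning
    e : ∀ c j w → suc c + 3 * (2 * j) + 3 * w ≡ c + 3 * w + 1 * suc (6 * j)
    e = solve-∀

  -- Over 2m consecutive u the values k run through two full progressions c + 3w, and the pairs
  -- ⌊k/2⌋ = ⌊c/2⌋ + 3w, ⌊(c+3)/2⌋ + 3w through two more.
  balanced-+2m : ∀ ρ N → Balanced ρ N → Balanced ρ (N + (m + m))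
  balanced-+2m ρ N balanced h = begin
      ∑ (λ u → h (k u % m)) (N + (m + m))
    ≡⟨ ∑-split _ N (m + m) ⟩
      ∑ (λ u → h (k u % m)) N + ∑ (λ v → h (k (N + v) % m)) (m + m)
    ≡⟨ cong₂ _+_ (balanced h) (trans (∑-cong (m + m) (λ v → cong (λ x → h (x % m)) (e₁ ρ N v)))
                                     (∑-split (λ v → h ((c + 3 * v) % m)) m m)) ⟩
      ∑ (λ u → h ((k u / 2) % m)) N + (∑-progression h c m + ∑ (λ v → h ((c + 3 * (m + v)) % m)) m)
    ≡⟨ cong (λ x → ∑ (λ u → h ((k u / 2) % m)) N + (∑-progression h c m + x)) (∑-cong m (λ v → cong (λ x → h (x % m)) (e₂ c m v))) ⟩
      ∑ (λ u → h ((k u / 2) % m)) N + (∑-progression h c m + ∑-progression h (c + 3 * m) m)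
    ≡⟨ cong (∑ (λ u → h ((k u / 2) % m)) N +_) (begin
           ∑-progression h c m + ∑-progression h (c + 3 * m) m
         ≡⟨ cong₂ _+_ (∑-progression-const h c) (∑-progression-const h (c + 3 * m)) ⟩
           ∑-progression h 0 m + ∑-progression h 0 m
         ≡⟨ cong₂ _+_ (∑-progression-const h (c / 2)) (∑-progression-const h ((c + 3) / 2)) ⟨
           ∑-progression h (c / 2) m + ∑-progression h ((c + 3) / 2) m
         ≡⟨ ∑-distrib-+ (λ w → h ((c / 2 + 3 * w) % m)) (λ w → h (((c + 3) / 2 + 3 * w) % m)) m ⟨
           ∑ (λ w → h ((c / 2 + 3 * w) % m) + h (((c + 3) / 2 + 3 * w) % m)) m
         ≡⟨ ∑-cong m (λ w → cong₂ _+_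
              (cong (λ x → h (x % m)) (trans (cong (_/ 2) (e₁ ρ N (w + w))) (half-+-6* c w)))
              (cong (λ x → h (x % m)) (trans (cong (_/ 2) (e₃ ρ N w)) (half-+-6* (c + 3) w)))) ⟨
           ∑ (λ w → g (w + w) + g (suc (w + w))) m
         ≡⟨ ∑-pairs g m ⟨
           ∑ g (m + m)
         ∎) ⟩
      ∑ (λ u → h ((k u / 2) % m)) N + ∑ g (m + m)
    ≡⟨ ∑-split _ N (m + m) ⟨
      ∑ (λ u → h ((k u / 2) % m)) (N + (m + m))
    ∎
    where
    open ≡-Reasoning
    k : ℕ → ℕ
    k u = suc (ρ + 3 * u)
    c = k N
    g : ℕ → ℕ
    g v = h ((k (N + v) / 2) % m)
    e₁ : ∀ ρ N v → suc (ρ + 3 * (N + v)) ≡ suc (ρ + 3 * N) + 3 * v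
    e₁ = solve-∀
    e₂ : ∀ c m v → c + 3 * (m + v) ≡ c + 3 * m + 3 * v
    e₂ = solve-∀
    e₃ : ∀ ρ N w → suc (ρ + 3 * (N + suc (w + w))) ≡ suc (ρ + 3 * N) + 3 + 3 * (w + w)
    e₃ = solve-∀

  balanced-+2m* : ∀ ρ N → Balanced ρ N → ∀ q → Balanced ρ (N + q * (m + m))
  balanced-+2m* ρ N balanced zero    = subst (Balanced ρ) (sym (+-identityʳ N)) balanced
  balanced-+2m* ρ N balanced (suc q) =
    subst (Balanced ρ) (e N q (m + m)) (balanced-+2m ρ (N + q * (m + m)) (balanced-+2m* ρ N balanced q))
    where
    e : ∀ N q M → N + q * M + M ≡ N + suc q * M
    e = solve-∀

  balanced-suc⇔ : ∀ ρ N → suc (ρ + 3 * N) % m ≡ (suc (ρ + 3 * N) / 2) % m →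
                  (Balanced ρ N → Balanced ρ (suc N)) × (Balanced ρ (suc N) → Balanced ρ N)
  balanced-suc⇔ ρ N k≡k/2 = extend , retract
    where
    A B : (ℕ → ℕ) → ℕ → ℕ
    A h u = h (suc (ρ + 3 * u) % m)
    B h u = h ((suc (ρ + 3 * u) / 2) % m)
    extend : Balanced ρ N → Balanced ρ (suc N)
    extend balanced h = trans (∑-suc (A h) N) (trans (cong₂ _+_ (balanced h) (cong h k≡k/2)) (sym (∑-suc (B h) N)))
    retract : Balanced ρ (suc N) → Balanced ρ N
    retract balanced h = +-cancelʳ-≡ _ _ _
      (trans (sym (∑-suc (A h) N)) (trans (balanced h) (trans (∑-suc (B h) N) (cong (∑ (B h) N +_) (sym (cong h k≡k/2))))))

  k≡k/2-mod : ∀ ρ N r a h q₁ q₂ → a < 2 → suc (ρ + 3 * N) ≡ r + q₁ * m → suc (ρ + 3 * N) ≡ a + h * 2 → h ≡ r + q₂ * m →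
              suc (ρ + 3 * N) % m ≡ (suc (ρ + 3 * N) / 2) % m
  k≡k/2-mod ρ N r a h q₁ q₂ a<2 k≡ k≡2h+a h≡ = begin
      suc (ρ + 3 * N) % m               ≡⟨ cong (_% m) k≡ ⟩
      (r + q₁ * m) % m                  ≡⟨ [m+kn]%n≡m%n r q₁ m ⟩
      r % m                             ≡⟨ [m+kn]%n≡m%n r q₂ m ⟨
      (r + q₂ * m) % m                  ≡⟨ cong (_% m) (trans (sym h≡) (trans (sym (proj₂ (divMod-unique a h a<2))) (cong (_/ 2) (sym k≡2h+a)))) ⟩
      (suc (ρ + 3 * N) / 2) % m         ∎
    where open ≡-Reasoning

  -- For u < 4j the values k = 3u + 2 reduce to the residues 2 + 3w (u = w) and 1 + 3w (u = 2j + w),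
  -- w < 2j, while the pairs u = 2w, 2w + 1 give ⌊k/2⌋ = 1 + 3w, 2 + 3w.
  balanced-1-4j : Balanced 1 ((j + j) + (j + j))
  balanced-1-4j h = begin
      ∑ (λ u → h (suc (1 + 3 * u) % m)) (p + p)
    ≡⟨ ∑-split _ p p ⟩
      ∑ (λ u → h (suc (1 + 3 * u) % m)) p + ∑ (λ w → h (suc (1 + 3 * (p + w)) % m)) p
    ≡⟨ cong₂ _+_ (∑-progression-shift h 2 0 _ p (e₁ j)) (∑-progression-shift h 1 1 _ p (e₂ j)) ⟩
      ∑-progression h 2 p + ∑-progression h 1 p
    ≡⟨ +-comm (∑-progression h 2 p) _ ⟩
      ∑-progression h 1 p + ∑-progression h 2 p
    ≡⟨ ∑-distrib-+ _ _ p ⟨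
      ∑ (λ w → h ((1 + 3 * w) % m) + h ((2 + 3 * w) % m)) p
    ≡⟨ ∑-cong p (λ w → cong₂ _+_ (cong (λ x → h (x % m)) (trans (cong (_/ 2) (e₃ w)) (half-+-6* 2 w)))
                                 (cong (λ x → h (x % m)) (trans (cong (_/ 2) (e₄ w)) (half-+-6* 5 w)))) ⟨
      ∑ (λ w → g (w + w) + g (suc (w + w))) p
    ≡⟨ ∑-pairs g p ⟨
      ∑ g (p + p)
    ∎
    where
    open ≡-Reasoning
    p = j + j
    g : ℕ → ℕ
    g u = h ((suc (1 + 3 * u) / 2) % m)
    e₁ : ∀ j w → suc (1 + 3 * w) ≡ 2 + 3 * w + 0 * suc (6 * j)
    e₁ = solve-∀
    e₂ : ∀ j w → suc (1 + 3 * ((j + j) + w)) ≡ 1 + 3 * w + 1 * suc (6 * j)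
    e₂ = solve-∀
    e₃ : ∀ w → suc (1 + 3 * (w + w)) ≡ 2 + 3 * (w + w)
    e₃ = solve-∀
    e₄ : ∀ w → suc (1 + 3 * suc (w + w)) ≡ 5 + 3 * (w + w)
    e₄ = solve-∀

  -- For u < 8j the values k = 3u + 3 reduce, in four blocks of 2j, to the residues 3 + 3w, 2 + 3w,
  -- 1 + 3w and 3w; the pairs u = 2w, 2w + 1 give ⌊k/2⌋ = 1 + 3w, 3 + 3w for w < 4j, the same residues.
  balanced-2-8j : Balanced 2 (((j + j) + (j + j)) + ((j + j) + (j + j)))
  balanced-2-8j h = begin
      ∑ (λ u → h (suc (2 + 3 * u) % m)) (q + q)
    ≡⟨ ∑-split _ q q ⟩
      ∑ (λ u → h (suc (2 + 3 * u) % m)) q + ∑ (λ w → h (suc (2 + 3 * (q + w)) % m)) q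
    ≡⟨ cong₂ _+_ (∑-split _ p p) (∑-split _ p p) ⟩
      (∑ (λ u → h (suc (2 + 3 * u) % m)) p + ∑ (λ w → h (suc (2 + 3 * (p + w)) % m)) p)
      + (∑ (λ u → h (suc (2 + 3 * (q + u)) % m)) p + ∑ (λ w → h (suc (2 + 3 * (q + (p + w))) % m)) p)
    ≡⟨ cong₂ _+_ (cong₂ _+_ (∑-progression-shift h 3 0 _ p (e₁ j)) (∑-progression-shift h 2 1 _ p (e₂ j)))
                 (cong₂ _+_ (∑-progression-shift h 1 2 _ p (e₃ j)) (∑-progression-shift h 0 3 _ p (e₄ j))) ⟩
      (∑-progression h 3 p + ∑-progression h 2 p) + (∑-progression h 1 p + ∑-progression h 0 p)
    ≡⟨ +-comm (∑-progression h 3 p + ∑-progression h 2 p) _ ⟩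
      (∑-progression h 1 p + ∑-progression h 0 p) + (∑-progression h 3 p + ∑-progression h 2 p)
    ≡⟨ cong₂ _+_ (trans (∑-split _ p p) (cong (∑-progression h 1 p +_) (∑-progression-shift h 0 1 _ p (e₅ j))))
                 (trans (∑-split _ p p) (cong (∑-progression h 3 p +_) (∑-progression-shift h 2 1 _ p (e₆ j)))) ⟨
      ∑-progression h 1 q + ∑-progression h 3 q
    ≡⟨ ∑-distrib-+ _ _ q ⟨
      ∑ (λ w → h ((1 + 3 * w) % m) + h ((3 + 3 * w) % m)) q
    ≡⟨ ∑-cong q (λ w → cong₂ _+_ (cong (λ x → h (x % m)) (trans (cong (_/ 2) (e₇ w)) (half-+-6* 3 w)))
                                 (cong (λ x → h (x % m)) (trans (cong (_/ 2) (e₈ w)) (half-+-6* 6 w)))) ⟨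
      ∑ (λ w → g (w + w) + g (suc (w + w))) q
    ≡⟨ ∑-pairs g q ⟨
      ∑ g (q + q)
    ∎
    where
    open ≡-Reasoning
    p = j + j
    q = p + p
    g : ℕ → ℕ
    g u = h ((suc (2 + 3 * u) / 2) % m)
    e₁ : ∀ j w → suc (2 + 3 * w) ≡ 3 + 3 * w + 0 * suc (6 * j)
    e₁ = solve-∀
    e₂ : ∀ j w → suc (2 + 3 * ((j + j) + w)) ≡ 2 + 3 * w + 1 * suc (6 * j)
    e₂ = solve-∀
    e₃ : ∀ j w → suc (2 + 3 * (((j + j) + (j + j)) + w)) ≡ 1 + 3 * w + 2 * suc (6 * j)
    e₃ = solve-∀
    e₄ : ∀ j w → suc (2 + 3 * (((j + j) + (j + j)) + ((j + j) + w))) ≡ 0 + 3 * w + 3 * suc (6 * j)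
    e₄ = solve-∀
    e₅ : ∀ j w → 1 + 3 * ((j + j) + w) ≡ 0 + 3 * w + 1 * suc (6 * j)
    e₅ = solve-∀
    e₆ : ∀ j w → 3 + 3 * ((j + j) + w) ≡ 2 + 3 * w + 1 * suc (6 * j)
    e₆ = solve-∀
    e₇ : ∀ w → suc (2 + 3 * (w + w)) ≡ 3 + 3 * (w + w)
    e₇ = solve-∀
    e₈ : ∀ w → suc (2 + 3 * suc (w + w)) ≡ 6 + 3 * (w + w)
    e₈ = solve-∀

  M : ℕ
  M = suc (5 + 6 * (6 * j))

  record BalancedResidue (r : ℕ) : Set where
    constructor balancedResidue
    field
      ρ k      : ℕ
      ρ<3      : ρ < 3
      r≡ρ+3k   : r ≡ ρ + k * 3
      balanced : Balanced ρ k

  balanced-of-residue : ∀ n r → n % M ≡ r → BalancedResidue r → Balanced (n % 3) (n / 3)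
  balanced-of-residue n r n%M≡r (balancedResidue ρ k ρ<3 r≡ρ+3k balanced) =
    subst₂ Balanced (sym (proj₁ ρ,k′)) (sym (proj₂ ρ,k′)) (balanced-+2m* ρ k balanced (n / M))
    where
    e : ∀ ρ k q j → ρ + k * 3 + q * suc (5 + 6 * (6 * j)) ≡ ρ + (k + q * (suc (6 * j) + suc (6 * j))) * 3
    e = solve-∀
    K = k + n / M * (m + m)
    n≡ : n ≡ ρ + K * 3
    n≡ = trans (m≡m%n+[m/n]*n n M) (trans (cong (_+ n / M * M) (trans n%M≡r r≡ρ+3k)) (e ρ k (n / M) j))
    ρ,k′ : (n % 3 ≡ ρ) × (n / 3 ≡ K)
    ρ,k′ = subst (λ x → (x % 3 ≡ ρ) × (x / 3 ≡ K)) (sym n≡) (divMod-unique ρ K ρ<3)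

  residue-0 : BalancedResidue 0
  residue-0 = balancedResidue 0 0 z<s refl (λ _ → refl)

  residue-1 : BalancedResidue 1
  residue-1 = balancedResidue 1 0 (s<s z<s) refl (λ _ → refl)

  residue-2 : BalancedResidue 2
  residue-2 = balancedResidue 2 0 (s<s (s<s z<s)) refl (λ _ → refl)

  residue-2m-1 : BalancedResidue (suc (12 * j))
  residue-2m-1 = balancedResidue 1 ((j + j) + (j + j)) (s<s z<s) (e j) balanced-1-4j
    where
    e : ∀ j → suc (12 * j) ≡ 1 + ((j + j) + (j + j)) * 3
    e = solve-∀

  residue-2m+2 : BalancedResidue (4 + 12 * j)
  residue-2m+2 = balancedResidue 1 (suc K) (s<s z<s) (e j)
    (proj₁ (balanced-suc⇔ 1 K (k≡k/2-mod 1 K 0 0 m 2 1 z<s (e₁ j) (e₂ j) (e₃ j))) balanced-1-4j)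
    where
    K = (j + j) + (j + j)
    e : ∀ j → 4 + 12 * j ≡ 1 + suc ((j + j) + (j + j)) * 3
    e = solve-∀
    e₁ : ∀ j → suc (1 + 3 * ((j + j) + (j + j))) ≡ 0 + 2 * suc (6 * j)
    e₁ = solve-∀
    e₂ : ∀ j → suc (1 + 3 * ((j + j) + (j + j))) ≡ 0 + suc (6 * j) * 2
    e₂ = solve-∀
    e₃ : ∀ j → suc (6 * j) ≡ 0 + 1 * suc (6 * j)
    e₃ = solve-∀

  residue-4m-2 : BalancedResidue (2 + 24 * j)
  residue-4m-2 = balancedResidue 2 (((j + j) + (j + j)) + ((j + j) + (j + j))) (s<s (s<s z<s)) (e j) balanced-2-8j
    where
    e : ∀ j → 2 + 24 * j ≡ 2 + (((j + j) + (j + j)) + ((j + j) + (j + j))) * 3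
    e = solve-∀

  residue-4m+1 : BalancedResidue (5 + 24 * j)
  residue-4m+1 = balancedResidue 2 (suc K) (s<s (s<s z<s)) (e j)
    (proj₁ (balanced-suc⇔ 2 K (k≡k/2-mod 2 K (6 * j) 1 (suc (12 * j)) 3 1 (s<s z<s) (e₁ j) (e₂ j) (e₃ j))) balanced-2-8j)
    where
    K = ((j + j) + (j + j)) + ((j + j) + (j + j))
    e : ∀ j → 5 + 24 * j ≡ 2 + suc (((j + j) + (j + j)) + ((j + j) + (j + j))) * 3
    e = solve-∀
    e₁ : ∀ j → suc (2 + 3 * (((j + j) + (j + j)) + ((j + j) + (j + j)))) ≡ 6 * j + 3 * suc (6 * j)
    e₁ = solve-∀
    e₂ : ∀ j → suc (2 + 3 * (((j + j) + (j + j)) + ((j + j) + (j + j)))) ≡ 1 + suc (12 * j) * 2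
    e₂ = solve-∀
    e₃ : ∀ j → suc (12 * j) ≡ 6 * j + 1 * suc (6 * j)
    e₃ = solve-∀

  balanced-2m : ∀ ρ → Balanced ρ (suc (suc (12 * j)))
  balanced-2m ρ = subst (Balanced ρ) (e j) (balanced-+2m ρ 0 (λ _ → refl))
    where
    e : ∀ j → suc (6 * j) + suc (6 * j) ≡ suc (suc (12 * j))
    e = solve-∀

  residue-6m-1 : BalancedResidue (5 + 36 * j)
  residue-6m-1 = balancedResidue 2 (suc (12 * j)) (s<s (s<s z<s)) (e j)
    (proj₂ (balanced-suc⇔ 2 (suc (12 * j)) (k≡k/2-mod 2 (suc (12 * j)) 0 0 (3 + 18 * j) 6 3 z<s (e₁ j) (e₂ j) (e₃ j))) (balanced-2m 2))
    where
    e : ∀ j → 5 + 36 * j ≡ 2 + suc (12 * j) * 3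
    e = solve-∀
    e₁ : ∀ j → suc (2 + 3 * suc (12 * j)) ≡ 0 + 6 * suc (6 * j)
    e₁ = solve-∀
    e₂ : ∀ j → suc (2 + 3 * suc (12 * j)) ≡ 0 + (3 + 18 * j) * 2
    e₂ = solve-∀
    e₃ : ∀ j → 3 + 18 * j ≡ 0 + 3 * suc (6 * j)
    e₃ = solve-∀

  residue-6m-2 : BalancedResidue (4 + 36 * j)
  residue-6m-2 = balancedResidue 1 (suc (12 * j)) (s<s z<s) (e j)
    (proj₂ (balanced-suc⇔ 1 (suc (12 * j)) (k≡k/2-mod 1 (suc (12 * j)) (6 * j) 1 (2 + 18 * j) 5 2 (s<s z<s) (e₁ j) (e₂ j) (e₃ j))) (balanced-2m 1))
    where
    e : ∀ j → 4 + 36 * j ≡ 1 + suc (12 * j) * 3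
    e = solve-∀
    e₁ : ∀ j → suc (1 + 3 * suc (12 * j)) ≡ 6 * j + 5 * suc (6 * j)
    e₁ = solve-∀
    e₂ : ∀ j → suc (1 + 3 * suc (12 * j)) ≡ 1 + (2 + 18 * j) * 2
    e₂ = solve-∀
    e₃ : ∀ j → 2 + 18 * j ≡ 6 * j + 2 * suc (6 * j)
    e₃ = solve-∀

  balanced-of-congPM : ∀ n a r → 0 < a → 0 < r → r + a ≡ M →
                       BalancedResidue a → BalancedResidue r → CongPM M n a → Balanced (n % 3) (n / 3)
  balanced-of-congPM n a r 0<a 0<r r+a≡M balanced-a balanced-r c =
    [ (λ n%M≡a → balanced-of-residue n a n%M≡a balanced-a) , (λ n%M≡r → balanced-of-residue n r n%M≡r balanced-r) ]
      (congPM-residue M n a r 0<a 0<r r+a≡M c)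

  balanced-of-congruences : ∀ n →
    (CongPM6 j n 0 ⊎ CongPM6 j n 1 ⊎ CongPM6 j n 2 ⊎ CongPM6 j n (2 * m′ j ∸ 1) ⊎ CongPM6 j n (2 * m′ j + 2)) →
    Balanced (n % 3) (n / 3)
  balanced-of-congruences n (inj₁ c) = balanced-of-residue n 0 (congPM-0 M n c) residue-0
  balanced-of-congruences n (inj₂ (inj₁ c)) =
    balanced-of-congPM n 1 (5 + 36 * j) z<s z<s (e₁ j) residue-1 residue-6m-1 c
    where
    e₁ : ∀ j → 5 + 36 * j + 1 ≡ suc (5 + 6 * (6 * j))
    e₁ = solve-∀
  balanced-of-congruences n (inj₂ (inj₂ (inj₁ c))) =
    balanced-of-congPM n 2 (4 + 36 * j) z<s z<s (e₂ j) residue-2 residue-6m-2 c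
    where
    e₂ : ∀ j → 4 + 36 * j + 2 ≡ suc (5 + 6 * (6 * j))
    e₂ = solve-∀
  balanced-of-congruences n (inj₂ (inj₂ (inj₂ (inj₁ c)))) =
    balanced-of-congPM n (suc (12 * j)) (5 + 24 * j) z<s z<s (e₃ j) residue-2m-1 residue-4m+1 (subst (CongPM M n) (2m-1≡ j) c)
    where
    2m-1≡ : ∀ j → 6 * j + suc (6 * j + 0) ≡ suc (12 * j)
    2m-1≡ = solve-∀
    e₃ : ∀ j → 5 + 24 * j + suc (12 * j) ≡ suc (5 + 6 * (6 * j))
    e₃ = solve-∀
  balanced-of-congruences n (inj₂ (inj₂ (inj₂ (inj₂ c)))) =
    balanced-of-congPM n (4 + 12 * j) (2 + 24 * j) z<s z<s (e₄ j) residue-2m+2 residue-4m-2 (subst (CongPM M n) (2m+2≡ j) c)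
    where
    2m+2≡ : ∀ j → suc (6 * j) + (suc (6 * j) + 0) + 2 ≡ 4 + 12 * j
    2m+2≡ = solve-∀
    e₄ : ∀ j → 2 + 24 * j + (4 + 12 * j) ≡ suc (5 + 6 * (6 * j))
    e₄ = solve-∀

theorem4 : (j : ℕ) → 0 < j → Prime (m′ j) →
    (n : ℕ) →
    (CongPM6 j n 0 ⊎ CongPM6 j n 1 ⊎ CongPM6 j n 2
    ⊎ CongPM6 j n (2 * (m′ j) ∸ 1)
    ⊎ CongPM6 j n (2 * (m′ j) + 2)) →
    (i : ℕ) → i < m′ j →
    crankCount (m′ j) n i ≡ p3 n / (m′ j)
theorem4 j _ _ n n≡±a i _ = Crank.crankCount≡p3/m (m′ j) n i (Balance.balanced-of-congruences j n n≡±a)
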